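{- Let $T^*$ be a tournament and $\pi$ a permutation of $V(T^*)$. Suppose that either $k\ge4$ is even and $T^*_L(\pi)$ contains a (not necessarily induced) copy $H$ of $K_{k,k}$, or $k\ge5$ is odd and $T^*_L(\pi)$ contains a (not necessarily induced) copy $H$ of $K_{k+1,k-1}$. Then there are four sets $X,Y,Z,W$ of $k$ vertices each such that inverting $X,Y,Z,W$ reverses the direction of the (tournament edges corresponding to the) edges of $H$ without affecting the direction of any other edge of $T^*$.
   Context: For a digraph $D$ and a permutation $\pi$ of $V(D)$, $D_L(\pi)$ is the undirected graph on $V(D)$ with edge $\{i,j\}$ iff $(i,j)\in E(D)$ and $\pi(i)<\pi(j)$. Inverting a vertex set means reversing all edges with both endpoints in it. -}

module Defs where

open import Data.Nat using (ℕ)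
open import Data.Bool using (Bool; true; false; _∧_; _∨_; if_then_else_)
open import Data.Fin using (Fin; _<_)
open import Data.Fin.Subset using (Subset; _∈_; Empty; _∩_; ∣_∣)
open import Data.Vec using (lookup)
open import Data.Fin.Permutation using (Permutation′; _⟨$⟩ʳ_)
open import Data.Product using (_×_)
open import Data.Sum using (_⊎_)
open import Relation.Binary.PropositionalEquality using (_≡_)
open import Relation.Nullary using (¬_)

Digraph : ℕ → Set
Digraph n = Fin n → Fin n → Bool

record IsTournament {n : ℕ} (E : Digraph n) : Set where
  field
    irrefl : ∀ i → E i i ≡ false
    total  : ∀ i j → ¬ (i ≡ j) → (E i j ∨ E j i) ≡ true
    asym   : ∀ i j → (E i j ∧ E j i) ≡ false

-- Edge {i,j} of the undirected graph D_L(π):  (i,j) ∈ E(D) and π(i) < π(j).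
-- (as an unordered pair, either orientation may witness it)
LEdge : ∀ {n} → Digraph n → Permutation′ n → Fin n → Fin n → Set
LEdge E π i j =
  (E i j ≡ true × (π ⟨$⟩ʳ i) < (π ⟨$⟩ʳ j)) ⊎ (E j i ≡ true × (π ⟨$⟩ʳ j) < (π ⟨$⟩ʳ i))

IsCopyOfK : ∀ {n} → Digraph n → Permutation′ n → ℕ → ℕ → Subset n → Subset n → Set
IsCopyOfK E π a b A B =
  Empty (A ∩ B) × ∣ A ∣ ≡ a × ∣ B ∣ ≡ b ×
  (∀ x y → x ∈ A → y ∈ B → LEdge E π x y)

bipEdge : ∀ {n} → Subset n → Subset n → Fin n → Fin n → Bool
bipEdge A B i j = (lookup A i ∧ lookup B j) ∨ (lookup B i ∧ lookup A j)

invert : ∀ {n} → Subset n → Digraph n → Digraph n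
invert X E i j = if lookup X i ∧ lookup X j then E j i else E i j

-- Inverting several sets reverses the arc between i and j exactly when an odd number of the
-- sets contain both i and j. Split A = A₁ ∪ A₂ and B = B₁ ∪ B₂ into halves (possible since
-- ∣A∣ and ∣B∣ are even: (k, k) for even k, (k + 1, k - 1) for odd k) and invert the four
-- sets Aₕ ∪ Bₕ′, each of size ∣A∣/2 + ∣B∣/2 = k. A pair in Aₕ × Bₕ′ lies in exactly one of
-- them, a pair inside some Aₕ or Bₕ′ in exactly two, and every other pair in none.

module Submission where

open import Defs
open import Data.Nat using (ℕ; zero; suc; _≤_; z≤n; s≤s; _+_; _*_; _∸_)
open import Data.Nat.Properties using (+-suc; +-comm; *-suc; *-identityʳ; m+n∸n≡m; m≤m+n)
open import Data.Nat.Divisibility using (_∣_; divides)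
open import Data.Bool using (Bool; true; false; _∧_; _∨_; _xor_; if_then_else_)
open import Data.Bool.Properties using (∧-comm; ∧-zeroʳ)
open import Data.Fin using (Fin; zero; suc)
open import Data.Fin.Subset using (Subset; ∣_∣; _∩_; Empty)
open import Data.Fin.Subset.Properties using (drop-∷-Empty)
open import Data.Fin.Permutation using (Permutation′)
open import Data.Vec using (Vec; []; _∷_; lookup; map; here)
open import Data.Vec.Properties using (lookup-map)
open import Data.List using (List; []; _∷_; foldr)
import Data.List as List
open import Data.Product using (_×_; _,_; ∃-syntax)
open import Data.Sum using (_⊎_; inj₁; inj₂)
open import Relation.Binary.PropositionalEquality
  using (_≡_; refl; sym; trans; cong; cong₂; subst; module ≡-Reasoning)
open import Relation.Nullary using (¬_; contradiction)

Twisted : ∀ {n} → Digraph n → (Fin n → Fin n → Bool) → Digraph n → Set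
Twisted T c E = ∀ i j → E i j ≡ (if c i j then T j i else T i j)

jointParity : ∀ {V : Set} → List (V → Bool) → V → V → Bool
jointParity []       x y = false
jointParity (P ∷ Ps) x y = (P x ∧ P y) xor jointParity Ps x y

jointParity-sym : ∀ {V : Set} (Ps : List (V → Bool)) x y →
  jointParity Ps x y ≡ jointParity Ps y x
jointParity-sym []       x y = refl
jointParity-sym (P ∷ Ps) x y = cong₂ _xor_ (∧-comm (P x) (P y)) (jointParity-sym Ps x y)

invert-twisted : ∀ {n} {T E : Digraph n} {c : Fin n → Fin n → Bool} (X : Subset n) →
  (∀ i j → c i j ≡ c j i) → Twisted T c E →
  Twisted T (λ i j → (lookup X i ∧ lookup X j) xor c i j) (invert X E)
invert-twisted {c = c} X c-sym tw i j
  rewrite tw i j | tw j i | c-sym j i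
  with lookup X i ∧ lookup X j | c i j
... | true  | true  = refl
... | true  | false = refl
... | false | _     = refl

invertAll-twisted : ∀ {n} (T : Digraph n) (Xs : List (Subset n)) →
  Twisted T (jointParity (List.map lookup Xs)) (foldr invert T Xs)
invertAll-twisted T []       i j = refl
invertAll-twisted T (X ∷ Xs) =
  invert-twisted X (jointParity-sym (List.map lookup Xs)) (invertAll-twisted T Xs)

data Half : Set where
  lower upper : Half

data Part : Set where
  outside : Part
  inA inB : Half → Part

sameHalf : Half → Half → Bool
sameHalf lower lower = true
sameHalf upper upper = true
sameHalf _     _     = false

inA? inB? : Half → Part → Bool
inA? h (inA h′) = sameHalf h h′
inA? h _        = false
inB? h (inB h′) = sameHalf h h′
inB? h _        = false

sideA sideB : Part → Bool
sideA (inA _) = true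
sideA _       = false
sideB (inB _) = true
sideB _       = false

crossing : Part → Part → Bool
crossing s t = (sideA s ∧ sideB t) ∨ (sideB s ∧ sideA t)

quarter : Half → Half → Part → Bool
quarter h h′ s = inA? h s ∨ inB? h′ s

quarters : List (Part → Bool)
quarters =
  quarter upper upper ∷ quarter upper lower ∷ quarter lower upper ∷ quarter lower lower ∷ []

jointParity-quarters : ∀ s t → jointParity quarters s t ≡ crossing s t
jointParity-quarters outside     _           = refl
jointParity-quarters (inA lower) outside     = refl
jointParity-quarters (inA lower) (inA lower) = refl
jointParity-quarters (inA lower) (inA upper) = refl
jointParity-quarters (inA lower) (inB lower) = refl
jointParity-quarters (inA lower) (inB upper) = refl
jointParity-quarters (inA upper) outside     = refl
jointParity-quarters (inA upper) (inA lower) = refl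
jointParity-quarters (inA upper) (inA upper) = refl
jointParity-quarters (inA upper) (inB lower) = refl
jointParity-quarters (inA upper) (inB upper) = refl
jointParity-quarters (inB lower) outside     = refl
jointParity-quarters (inB lower) (inA lower) = refl
jointParity-quarters (inB lower) (inA upper) = refl
jointParity-quarters (inB lower) (inB lower) = refl
jointParity-quarters (inB lower) (inB upper) = refl
jointParity-quarters (inB upper) outside     = refl
jointParity-quarters (inB upper) (inA lower) = refl
jointParity-quarters (inB upper) (inA upper) = refl
jointParity-quarters (inB upper) (inB lower) = refl
jointParity-quarters (inB upper) (inB upper) = refl

jointParity-lookup-map : ∀ {V : Set} {n} (Ps : List (V → Bool)) (v : Vec V n) i j →
  jointParity (List.map (λ P → lookup (map P v)) Ps) i j ≡ jointParity Ps (lookup v i) (lookup v j)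
jointParity-lookup-map []       v i j = refl
jointParity-lookup-map (P ∷ Ps) v i j =
  cong₂ _xor_ (cong₂ _∧_ (lookup-map i P v) (lookup-map j P v)) (jointParity-lookup-map Ps v i j)

∣map-∨∣ : ∀ {V : Set} {n} (f g : V → Bool) → (∀ x → f x ∧ g x ≡ false) → (v : Vec V n) →
  ∣ map (λ x → f x ∨ g x) v ∣ ≡ ∣ map f v ∣ + ∣ map g v ∣
∣map-∨∣ f g disj []      = refl
∣map-∨∣ f g disj (x ∷ v) with f x | g x | disj x
... | false | false | _ = ∣map-∨∣ f g disj v
... | true  | false | _ = cong suc (∣map-∨∣ f g disj v)
... | false | true  | _ = trans (cong suc (∣map-∨∣ f g disj v)) (sym (+-suc _ _))
... | true  | true  | ()

inA?∧inB? : ∀ h h′ s → inA? h s ∧ inB? h′ s ≡ false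
inA?∧inB? h h′ outside  = refl
inA?∧inB? h h′ (inA g) = ∧-zeroʳ (sameHalf h g)
inA?∧inB? h h′ (inB g) = refl

label : ∀ {n} → Subset n → Subset n → ℕ → ℕ → Vec Part n
label []          []          p       q       = []
label (true ∷ A)  (_ ∷ B)     zero    q       = inA upper ∷ label A B zero q
label (true ∷ A)  (_ ∷ B)     (suc p) q       = inA lower ∷ label A B p q
label (false ∷ A) (true ∷ B)  p       zero    = inB upper ∷ label A B p zero
label (false ∷ A) (true ∷ B)  p       (suc q) = inB lower ∷ label A B p q
label (false ∷ A) (false ∷ B) p       q       = outside ∷ label A B p q

label-sides : ∀ {n} (A B : Subset n) p q → Empty (A ∩ B) → ∀ i →
  lookup A i ≡ sideA (lookup (label A B p q) i) × lookup B i ≡ sideB (lookup (label A B p q) i)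
label-sides (true ∷ A)  (true ∷ B)  p       q       d i       = contradiction (zero , here) d
label-sides (true ∷ A)  (false ∷ B) zero    q       d zero    = refl , refl
label-sides (true ∷ A)  (false ∷ B) zero    q       d (suc i) = label-sides A B zero q (drop-∷-Empty d) i
label-sides (true ∷ A)  (false ∷ B) (suc p) q       d zero    = refl , refl
label-sides (true ∷ A)  (false ∷ B) (suc p) q       d (suc i) = label-sides A B p q (drop-∷-Empty d) i
label-sides (false ∷ A) (true ∷ B)  p       zero    d zero    = refl , refl
label-sides (false ∷ A) (true ∷ B)  p       zero    d (suc i) = label-sides A B p zero (drop-∷-Empty d) i
label-sides (false ∷ A) (true ∷ B)  p       (suc q) d zero    = refl , refl
label-sides (false ∷ A) (true ∷ B)  p       (suc q) d (suc i) = label-sides A B p q (drop-∷-Empty d) i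
label-sides (false ∷ A) (false ∷ B) p       q       d zero    = refl , refl
label-sides (false ∷ A) (false ∷ B) p       q       d (suc i) = label-sides A B p q (drop-∷-Empty d) i

bipEdge-label : ∀ {n} (A B : Subset n) p q → Empty (A ∩ B) → ∀ i j →
  bipEdge A B i j ≡ crossing (lookup (label A B p q) i) (lookup (label A B p q) j)
bipEdge-label A B p q disj i j with label-sides A B p q disj i | label-sides A B p q disj j
... | Ai , Bi | Aj , Bj = cong₂ _∨_ (cong₂ _∧_ Ai Bj) (cong₂ _∧_ Bi Aj)

label-counts : ∀ {n} (A B : Subset n) p q → Empty (A ∩ B) → p ≤ ∣ A ∣ → q ≤ ∣ B ∣ →
  let v = label A B p q in
  ∣ map (inA? lower) v ∣ ≡ p × ∣ map (inA? upper) v ∣ ≡ ∣ A ∣ ∸ p ×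
  ∣ map (inB? lower) v ∣ ≡ q × ∣ map (inB? upper) v ∣ ≡ ∣ B ∣ ∸ q
label-counts []          []          zero    zero    d z≤n      z≤n      = refl , refl , refl , refl
label-counts (true ∷ A)  (true ∷ B)  p       q       d _        _        = contradiction (zero , here) d
label-counts (true ∷ A)  (false ∷ B) zero    q       d _        q≤
  with label-counts A B zero q (drop-∷-Empty d) z≤n q≤
... | e₁ , e₂ , e₃ , e₄ = e₁ , cong suc e₂ , e₃ , e₄
label-counts (true ∷ A)  (false ∷ B) (suc p) q       d (s≤s p≤) q≤
  with label-counts A B p q (drop-∷-Empty d) p≤ q≤
... | e₁ , e₂ , e₃ , e₄ = cong suc e₁ , e₂ , e₃ , e₄
label-counts (false ∷ A) (true ∷ B)  p       zero    d p≤       _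
  with label-counts A B p zero (drop-∷-Empty d) p≤ z≤n
... | e₁ , e₂ , e₃ , e₄ = e₁ , e₂ , e₃ , cong suc e₄
label-counts (false ∷ A) (true ∷ B)  p       (suc q) d p≤       (s≤s q≤)
  with label-counts A B p q (drop-∷-Empty d) p≤ q≤
... | e₁ , e₂ , e₃ , e₄ = e₁ , e₂ , cong suc e₃ , e₄
label-counts (false ∷ A) (false ∷ B) p       q       d p≤       q≤       =
  label-counts A B p q (drop-∷-Empty d) p≤ q≤

m≡n+n⇒n≤m : ∀ {m n} → m ≡ n + n → n ≤ m
m≡n+n⇒n≤m {n = n} refl = m≤m+n n n

m≡n+n⇒m∸n≡n : ∀ {m n} → m ≡ n + n → m ∸ n ≡ n
m≡n+n⇒m∸n≡n {n = n} refl = m+n∸n≡m n n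

FourInversionsReverse : ∀ {n} → Digraph n → Subset n → Subset n → ℕ → Set
FourInversionsReverse {n} T A B k =
  ∃[ X ] ∃[ Y ] ∃[ Z ] ∃[ W ]
    (∣ X ∣ ≡ k × ∣ Y ∣ ≡ k × ∣ Z ∣ ≡ k × ∣ W ∣ ≡ k ×
     (∀ (i j : Fin n) → ¬ (i ≡ j) →
        invert W (invert Z (invert Y (invert X T))) i j
          ≡ (if bipEdge A B i j then T j i else T i j)))

fourInversionsReverse : ∀ {n} (T : Digraph n) (A B : Subset n) → Empty (A ∩ B) → ∀ a b →
  ∣ A ∣ ≡ a + a → ∣ B ∣ ≡ b + b → FourInversionsReverse T A B (a + b)
fourInversionsReverse T A B disj a b ∣A∣≡a+a ∣B∣≡b+b
  with label-counts A B a b disj (m≡n+n⇒n≤m ∣A∣≡a+a) (m≡n+n⇒n≤m ∣B∣≡b+b)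
... | #A-lower , #A-upper , #B-lower , #B-upper =
  set lower lower , set lower upper , set upper lower , set upper upper ,
  size lower lower , size lower upper , size upper lower , size upper upper ,
  λ i j _ → reverses i j
  where
  open ≡-Reasoning

  v : Vec Part _
  v = label A B a b

  set : Half → Half → Subset _
  set h h′ = map (quarter h h′) v

  sizeA : ∀ h → ∣ map (inA? h) v ∣ ≡ a
  sizeA lower = #A-lower
  sizeA upper = trans #A-upper (m≡n+n⇒m∸n≡n ∣A∣≡a+a)

  sizeB : ∀ h → ∣ map (inB? h) v ∣ ≡ b
  sizeB lower = #B-lower
  sizeB upper = trans #B-upper (m≡n+n⇒m∸n≡n ∣B∣≡b+b)

  size : ∀ h h′ → ∣ set h h′ ∣ ≡ a + b
  size h h′ = trans (∣map-∨∣ (inA? h) (inB? h′) (inA?∧inB? h h′) v)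
                    (cong₂ _+_ (sizeA h) (sizeB h′))

  reverses : ∀ i j → invert (set upper upper) (invert (set upper lower)
                       (invert (set lower upper) (invert (set lower lower) T))) i j
                     ≡ (if bipEdge A B i j then T j i else T i j)
  reverses i j = begin
    _ ≡⟨ invertAll-twisted T (List.map (λ P → map P v) quarters) i j ⟩
    (if jointParity (List.map (λ P → lookup (map P v)) quarters) i j then T j i else T i j)
      ≡⟨ cong (if_then T j i else T i j) parity≡bipEdge ⟩
    (if bipEdge A B i j then T j i else T i j) ∎
    where
    parity≡bipEdge : jointParity (List.map (λ P → lookup (map P v)) quarters) i j ≡ bipEdge A B i j
    parity≡bipEdge = begin
      _ ≡⟨ jointParity-lookup-map quarters v i j ⟩
      jointParity quarters (lookup v i) (lookup v j)
        ≡⟨ jointParity-quarters (lookup v i) (lookup v j) ⟩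
      crossing (lookup v i) (lookup v j)
        ≡⟨ sym (bipEdge-label A B a b disj i j) ⟩
      bipEdge A B i j ∎

m*2≡m+m : ∀ m → m * 2 ≡ m + m
m*2≡m+m m = trans (*-suc m 1) (cong (m +_) (*-identityʳ m))

even-or-odd : ∀ k → ∃[ m ] (k ≡ m + m ⊎ k ≡ suc (m + m))
even-or-odd zero = 0 , inj₁ refl
even-or-odd (suc k) with even-or-odd k
... | m , inj₁ refl = m , inj₂ refl
... | m , inj₂ refl = suc m , inj₁ (cong suc (sym (+-suc m m)))

lemma4p3 : (n k : ℕ) (T : Digraph n) → IsTournament T → (π : Permutation′ n) →
    (A B : Subset n) →
    ((4 ≤ k × 2 ∣ k × IsCopyOfK T π k k A B) ⊎
     (5 ≤ k × ¬ (2 ∣ k) × IsCopyOfK T π (k + 1) (k ∸ 1) A B)) →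
    ∃[ X ] ∃[ Y ] ∃[ Z ] ∃[ W ]
      (∣ X ∣ ≡ k × ∣ Y ∣ ≡ k × ∣ Z ∣ ≡ k × ∣ W ∣ ≡ k ×
       (∀ (i j : Fin n) → ¬ (i ≡ j) →
          invert W (invert Z (invert Y (invert X T))) i j
            ≡ (if bipEdge A B i j then T j i else T i j)))
lemma4p3 n k T _ _ A B (inj₁ (_ , divides q k≡q*2 , disj , ∣A∣≡k , ∣B∣≡k , _)) =
  subst (FourInversionsReverse T A B) (sym k≡q+q)
    (fourInversionsReverse T A B disj q q (trans ∣A∣≡k k≡q+q) (trans ∣B∣≡k k≡q+q))
  where
  k≡q+q : k ≡ q + q
  k≡q+q = trans k≡q*2 (m*2≡m+m q)
lemma4p3 n k T _ _ A B (inj₂ (_ , k-odd , disj , ∣A∣≡k+1 , ∣B∣≡k∸1 , _)) with even-or-odd k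
... | m , inj₁ refl = contradiction (divides m (sym (m*2≡m+m m))) k-odd
... | m , inj₂ refl =
  fourInversionsReverse T A B disj (suc m) m
    (trans ∣A∣≡k+1 k+1≡a+a) ∣B∣≡k∸1
  where
  k+1≡a+a : suc (m + m) + 1 ≡ suc m + suc m
  k+1≡a+a = trans (+-comm (suc (m + m)) 1) (cong suc (sym (+-suc m m)))
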